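{- For every integer $n\geq 4$, the graph $C_n^+$ consisting of a cycle $C_n$ together with one chord is total prime.
   Context: All graphs are finite and simple. For a graph $G$ with vertex set $V$ and edge set $E$, a total prime labeling is a bijection $\ell: V\cup E\to\{1,2,\ldots,|V|+|E|\}$ such that (i) for every pair of adjacent vertices $u,v$, $\gcd(\ell(u),\ell(v))=1$, and (ii) for every vertex $v$ of degree at least 2, the greatest common divisor of the labels $\ell(uv)$ over all edges $uv$ incident to $v$ equals 1. A graph is total prime if it admits a total prime labeling. $C_n^+$ denotes the graph obtained from the cycle $C_n$ by adding one edge (a chord) joining two non-adjacent vertices of the cycle; the claim holds for any choice of chord. -}

module Defs where

open import Data.Nat using (ℕ; zero; suc; _+_; _≤_; NonZero)
open import Data.Nat.Properties using (_≟_)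
open import Data.Nat.GCD using (gcd)
open import Data.Nat.Coprimality using (Coprime)
open import Data.Nat.DivMod using (_%_; m%n<n)
open import Data.Fin using (Fin; toℕ; fromℕ<)
import Data.Fin.Properties as FinP
open import Data.Sum using (_⊎_; inj₁; inj₂)
open import Data.Product using (_×_; _,_; proj₁; proj₂; Σ)
open import Data.List using (List; map; filter; foldr; length; allFin)
open import Relation.Binary.PropositionalEquality using (_≡_)
open import Relation.Nullary using (¬_)
open import Relation.Nullary.Decidable using (_⊎-dec_)
open import Function.Definitions using (Bijective)

record Graph : Set where
  field
    nV   : ℕ
    nE   : ℕ
    ends : Fin nE → Fin nV × Fin nV

open Graph public

-- A labeling assigns to each vertex/edge a label in {1,…,|V|+|E|}:
-- the element i : Fin (|V|+|E|) stands for the label toℕ i + 1.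
Labeling : Graph → Set
Labeling G = Fin (nV G) ⊎ Fin (nE G) → Fin (nV G + nE G)

lab : (G : Graph) → Labeling G → Fin (nV G) ⊎ Fin (nE G) → ℕ
lab G f x = suc (toℕ (f x))

incident : (G : Graph) → Fin (nV G) → List (Fin (nE G))
incident G v = filter (λ e → (v FinP.≟ proj₁ (ends G e)) ⊎-dec (v FinP.≟ proj₂ (ends G e)))
                      (allFin (nE G))

degree : (G : Graph) → Fin (nV G) → ℕ
degree G v = length (incident G v)

gcdList : List ℕ → ℕ
gcdList = foldr gcd 0

record IsTotalPrimeLabeling (G : Graph) (f : Labeling G) : Set where
  field
    bijective   : Bijective _≡_ _≡_ f
    vertexCond  : (e : Fin (nE G)) →
                  Coprime (lab G f (inj₁ (proj₁ (ends G e)))) (lab G f (inj₁ (proj₂ (ends G e))))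
    edgeCond    : (v : Fin (nV G)) → 2 ≤ degree G v →
                  gcdList (map (λ e → lab G f (inj₂ e)) (incident G v)) ≡ 1

TotalPrime : Graph → Set
TotalPrime G = Σ (Labeling G) (IsTotalPrimeLabeling G)

next : (n : ℕ) .{{_ : NonZero n}} → Fin n → Fin n
next n i = fromℕ< (m%n<n (suc (toℕ i)) n)

-- C_n^+ : cycle edges e_i = {i, i+1 mod n} for i < n, plus the chord {a,b} as edge n.
CnPlusEnds : (n : ℕ) .{{_ : NonZero n}} → Fin n → Fin n → Fin (suc n) → Fin n × Fin n
CnPlusEnds n a b e with toℕ e ≟ n
... | Relation.Nullary.yes _ = a , b
... | Relation.Nullary.no _  = i , next n i
  where i = fromℕ< {toℕ e % n} (m%n<n (toℕ e) n)

CnPlus : (n : ℕ) .{{_ : NonZero n}} → Fin n → Fin n → Graph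
CnPlus n a b = record { nV = n ; nE = suc n ; ends = CnPlusEnds n a b }

NonAdjacentOnCycle : (n : ℕ) .{{_ : NonZero n}} → Fin n → Fin n → Set
NonAdjacentOnCycle n a b = (¬ a ≡ b) × (¬ b ≡ next n a) × (¬ a ≡ next n b)

{-# OPTIONS --safe #-}
module Submission where

-- Rotate the cycle so that the chord endpoint a comes first: with r v = (v − a) mod n, label
-- vertex v by 1 + r v, the cycle edge {v, v + 1} by n + 1 + r v, and the chord by 2n + 1.
-- Adjacent cycle vertices then carry consecutive labels or the pair n, 1, and the chord meets
-- the label 1. A vertex v ≠ a lies on two cycle edges with consecutive labels, while a lies on
-- the edges labelled n + 1 and 2n + 1, which are coprime since they differ by n.

open import Defs
open import Data.Nat using (ℕ; zero; suc; _+_; _∸_; _≤_; NonZero; >-nonZero⁻¹)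
open import Data.Nat.Properties
  using (_<?_; <⇒≢; <⇒≤; +-comm; +-assoc; +-suc; +-identityʳ; suc-injective; ≤-antisym; ≮⇒≥;
         m+[n∸m]≡n; m∸n+n≡m)
  renaming (_≟_ to _ℕ≟_)
open import Data.Nat.DivMod
  using (_%_; _mod_; m%n<n; m<n⇒m%n≡m; n%n≡0; %-distribˡ-+; m%n%n≡m%n; [m+n]%n≡m%n)
open import Data.Nat.Divisibility using (_∣_; ∣-trans; ∣m+n∣m⇒∣n; ∣1⇒≡1)
open import Data.Nat.GCD using (gcd[m,n]∣m; gcd[m,n]∣n)
open import Data.Nat.Coprimality using (Coprime; 1-coprimeTo; coprime-+)
import Data.Nat.Coprimality as Coprime
open import Data.Fin using (Fin; zero; suc; toℕ; fromℕ; inject₁; punchIn; _↑ʳ_)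
open import Data.Fin.Properties
  using (toℕ-injective; toℕ<n; toℕ-fromℕ; toℕ-fromℕ<; toℕ-inject₁; toℕ-↑ˡ; toℕ-↑ʳ;
         +↔⊎; _≟_)
open import Data.Fin.Permutation
  using (Permutation′; permutation; insert; insert-punchIn; _⟨$⟩ʳ_)
open import Data.Fin.Relation.Unary.Top using (view; ‵fromℕ; ‵inject₁)
open import Data.Sum using (_⊎_; inj₁; inj₂)
open import Data.Sum.Function.Propositional using (_⊎-↔_)
open import Data.Product using (_,_; proj₁; proj₂)
open import Data.List using (_∷_; map)
open import Data.List.Membership.Propositional using (_∈_)
open import Data.List.Relation.Unary.Any using (here; there)
open import Data.List.Membership.Propositional.Properties using (∈-map⁺; ∈-filter⁺; ∈-allFin)
open import Function.Bundles using (_↔_; Inverse; Bijection)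
open import Function.Construct.Composition using (_↔-∘_)
open import Function.Construct.Symmetry using (↔-sym)
open import Function.Properties.Inverse using (Inverse⇒Bijection)
open import Relation.Binary.PropositionalEquality
  using (_≡_; refl; sym; trans; cong; subst; subst₂; module ≡-Reasoning)
open import Relation.Nullary using (yes; no; contradiction)
open import Relation.Nullary.Decidable using (_⊎-dec_)

coprime-suc : ∀ k → Coprime k (suc k)
coprime-suc k {d} (d∣k , d∣1+k) = ∣1⇒≡1 (∣m+n∣m⇒∣n (subst (d ∣_) (+-comm 1 k) d∣1+k) d∣k)

coprime-[1+n]-[1+2n] : ∀ n → Coprime (suc n) (suc (n + n))
coprime-[1+n]-[1+2n] n = Coprime.sym (coprime-+ (coprime-suc n))

gcdList-∣ : ∀ {x xs} → x ∈ xs → gcdList xs ∣ x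
gcdList-∣ {x} {.x ∷ xs} (here refl) = gcd[m,n]∣m x (gcdList xs)
gcdList-∣ {x} {y ∷ xs}  (there x∈xs) = ∣-trans (gcd[m,n]∣n y (gcdList xs)) (gcdList-∣ x∈xs)

coprime-members⇒gcdList≡1 : ∀ {x y xs} → x ∈ xs → y ∈ xs → Coprime x y → gcdList xs ≡ 1
coprime-members⇒gcdList≡1 x∈xs y∈xs coprime = coprime (gcdList-∣ x∈xs , gcdList-∣ y∈xs)

IsEndpoint : (G : Graph) → Fin (nV G) → Fin (nE G) → Set
IsEndpoint G v e = v ≡ proj₁ (ends G e) ⊎ v ≡ proj₂ (ends G e)

∈-incident : (G : Graph) {v : Fin (nV G)} {e : Fin (nE G)} → IsEndpoint G v e → e ∈ incident G v
∈-incident G {v} {e} =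
  ∈-filter⁺ (λ e → (v ≟ proj₁ (ends G e)) ⊎-dec (v ≟ proj₂ (ends G e))) (∈-allFin e)

edgeLabelGcd : (G : Graph) → Labeling G → Fin (nV G) → ℕ
edgeLabelGcd G f v = gcdList (map (λ e → lab G f (inj₂ e)) (incident G v))

coprime-edges⇒edgeLabelGcd≡1 : (G : Graph) (f : Labeling G) {v : Fin (nV G)} {e e′ : Fin (nE G)} →
  IsEndpoint G v e → IsEndpoint G v e′ → Coprime (lab G f (inj₂ e)) (lab G f (inj₂ e′)) →
  edgeLabelGcd G f v ≡ 1
coprime-edges⇒edgeLabelGcd≡1 G f v∈e v∈e′ = coprime-members⇒gcdList≡1
  (∈-map⁺ (λ e → lab G f (inj₂ e)) (∈-incident G v∈e))
  (∈-map⁺ (λ e → lab G f (inj₂ e)) (∈-incident G v∈e′))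

punchIn-fromℕ : ∀ {n} (i : Fin n) → punchIn (fromℕ n) i ≡ inject₁ i
punchIn-fromℕ zero    = refl
punchIn-fromℕ (suc i) = cong suc (punchIn-fromℕ i)

liftLast : ∀ {n} → Permutation′ n → Permutation′ (suc n)
liftLast {n} = insert (fromℕ n) (fromℕ n)

liftLast-fromℕ : ∀ {n} (π : Permutation′ n) → liftLast π ⟨$⟩ʳ fromℕ n ≡ fromℕ n
liftLast-fromℕ {n} π with fromℕ n ≟ fromℕ n
... | yes _    = refl
... | no ≢self = contradiction refl ≢self

liftLast-inject₁ : ∀ {n} (π : Permutation′ n) i → liftLast π ⟨$⟩ʳ inject₁ i ≡ inject₁ (π ⟨$⟩ʳ i)
liftLast-inject₁ {n} π i = begin
  liftLast π ⟨$⟩ʳ inject₁ i               ≡⟨ cong (liftLast π ⟨$⟩ʳ_) (sym (punchIn-fromℕ i)) ⟩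
  liftLast π ⟨$⟩ʳ punchIn (fromℕ n) i     ≡⟨ insert-punchIn (fromℕ n) (fromℕ n) π i ⟩
  punchIn (fromℕ n) (π ⟨$⟩ʳ i)            ≡⟨ punchIn-fromℕ (π ⟨$⟩ʳ i) ⟩
  inject₁ (π ⟨$⟩ʳ i)                      ∎
  where open ≡-Reasoning

[m+n%d]%d≡[m+n]%d : ∀ m n d .{{_ : NonZero d}} → (m + n % d) % d ≡ (m + n) % d
[m+n%d]%d≡[m+n]%d m n d = begin
  (m + n % d) % d           ≡⟨ %-distribˡ-+ m (n % d) d ⟩
  (m % d + n % d % d) % d   ≡⟨ cong (λ r → (m % d + r) % d) (m%n%n≡m%n n d) ⟩
  (m % d + n % d) % d       ≡⟨ sym (%-distribˡ-+ m n d) ⟩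
  (m + n) % d               ∎
  where open ≡-Reasoning

module _ {n : ℕ} .{{_ : NonZero n}} where

  rotate : ℕ → Fin n → Fin n
  rotate k i = (k + toℕ i) mod n

  toℕ-rotate : ∀ k i → toℕ (rotate k i) ≡ (k + toℕ i) % n
  toℕ-rotate k i = toℕ-fromℕ< (m%n<n (k + toℕ i) n)

  rotate-rotate : ∀ j k i → rotate j (rotate k i) ≡ rotate (j + k) i
  rotate-rotate j k i = toℕ-injective (begin
    toℕ (rotate j (rotate k i))  ≡⟨ toℕ-rotate j (rotate k i) ⟩
    (j + toℕ (rotate k i)) % n   ≡⟨ cong (λ r → (j + r) % n) (toℕ-rotate k i) ⟩
    (j + (k + toℕ i) % n) % n    ≡⟨ [m+n%d]%d≡[m+n]%d j (k + toℕ i) n ⟩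
    (j + (k + toℕ i)) % n        ≡⟨ cong (_% n) (sym (+-assoc j k (toℕ i))) ⟩
    (j + k + toℕ i) % n          ≡⟨ sym (toℕ-rotate (j + k) i) ⟩
    toℕ (rotate (j + k) i)       ∎)
    where open ≡-Reasoning

  rotate-n : ∀ i → rotate n i ≡ i
  rotate-n i = toℕ-injective (begin
    toℕ (rotate n i)  ≡⟨ toℕ-rotate n i ⟩
    (n + toℕ i) % n   ≡⟨ cong (_% n) (+-comm n (toℕ i)) ⟩
    (toℕ i + n) % n   ≡⟨ [m+n]%n≡m%n (toℕ i) n ⟩
    toℕ i % n         ≡⟨ m<n⇒m%n≡m (toℕ<n i) ⟩
    toℕ i             ∎)
    where open ≡-Reasoning

  rotate-inverse : ∀ {j k} → j + k ≡ n → ∀ i → rotate j (rotate k i) ≡ i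
  rotate-inverse {j} {k} j+k≡n i =
    trans (rotate-rotate j k i) (trans (cong (λ s → rotate s i) j+k≡n) (rotate-n i))

  -- next n i is rotate 1 i by definition.
  rotate-next : ∀ k i → rotate k (next n i) ≡ next n (rotate k i)
  rotate-next k i = begin
    rotate k (rotate 1 i)   ≡⟨ rotate-rotate k 1 i ⟩
    rotate (k + 1) i        ≡⟨ cong (λ s → rotate s i) (+-comm k 1) ⟩
    rotate (1 + k) i        ≡⟨ sym (rotate-rotate 1 k i) ⟩
    rotate 1 (rotate k i)   ∎
    where open ≡-Reasoning

  prev : Fin n → Fin n
  prev = rotate (n ∸ 1)

  next-prev : ∀ i → next n (prev i) ≡ i
  next-prev = rotate-inverse (m+[n∸m]≡n (>-nonZero⁻¹ n))

  toℕ-next : ∀ i → toℕ (next n i) ≡ suc (toℕ i) ⊎ toℕ (next n i) ≡ 0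
  toℕ-next i with suc (toℕ i) <? n
  ... | yes 1+i<n = inj₁ (trans (toℕ-rotate 1 i) (m<n⇒m%n≡m 1+i<n))
  ... | no  1+i≮n = inj₂ (begin
    toℕ (next n i)    ≡⟨ toℕ-rotate 1 i ⟩
    suc (toℕ i) % n   ≡⟨ cong (_% n) (≤-antisym (toℕ<n i) (≮⇒≥ 1+i≮n)) ⟩
    n % n             ≡⟨ n%n≡0 n ⟩
    0                 ∎)
    where open ≡-Reasoning

  toℕ-next≡suc⇒toℕ≡ : ∀ {i t} → toℕ (next n i) ≡ suc t → toℕ i ≡ t
  toℕ-next≡suc⇒toℕ≡ {i} next≡1+t with toℕ-next i
  ... | inj₁ next≡1+i = suc-injective (trans (sym next≡1+i) next≡1+t)
  ... | inj₂ next≡0   = contradiction (trans (sym next≡0) next≡1+t) λ ()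

  coprime-next : ∀ i → Coprime (suc (toℕ i)) (suc (toℕ (next n i)))
  coprime-next i with toℕ (next n i) | toℕ-next i
  ... | _ | inj₁ refl = coprime-suc (suc (toℕ i))
  ... | _ | inj₂ refl = Coprime.sym (1-coprimeTo _)

  rotation : Fin n → Permutation′ n
  rotation a = permutation (rotate (n ∸ toℕ a)) (rotate (toℕ a))
    (rotate-inverse (m∸n+n≡m (<⇒≤ (toℕ<n a)))) (rotate-inverse (m+[n∸m]≡n (<⇒≤ (toℕ<n a))))

  toℕ-rotation-self : ∀ a → toℕ (rotation a ⟨$⟩ʳ a) ≡ 0
  toℕ-rotation-self a = begin
    toℕ (rotate (n ∸ toℕ a) a)   ≡⟨ toℕ-rotate (n ∸ toℕ a) a ⟩
    (n ∸ toℕ a + toℕ a) % n      ≡⟨ cong (_% n) (m∸n+n≡m (<⇒≤ (toℕ<n a))) ⟩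
    n % n                        ≡⟨ n%n≡0 n ⟩
    0                            ∎
    where open ≡-Reasoning

  rotation-self-unique : ∀ a {v} → toℕ (rotation a ⟨$⟩ʳ v) ≡ 0 → v ≡ a
  rotation-self-unique a ρv≡0 =
    Bijection.injective (Inverse⇒Bijection (rotation a))
      (toℕ-injective (trans ρv≡0 (sym (toℕ-rotation-self a))))

module _ {n : ℕ} .{{_ : NonZero n}} (a b : Fin n) where

  private
    G : Graph
    G = CnPlus n a b

    ρ : Permutation′ n
    ρ = rotation a

  ends-chord : ends G (fromℕ n) ≡ (a , b)
  ends-chord with toℕ (fromℕ n) ℕ≟ n
  ... | yes _   = refl
  ... | no  ≢n  = contradiction (toℕ-fromℕ n) ≢n

  ends-cycle : ∀ i → ends G (inject₁ i) ≡ (i , next n i)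
  ends-cycle i with toℕ (inject₁ i) ℕ≟ n
  ... | yes ≡n  = contradiction (trans (sym (toℕ-inject₁ i)) ≡n) (<⇒≢ (toℕ<n i))
  ... | no  _   = cong (λ j → j , next n j) (toℕ-injective (begin
    toℕ (toℕ (inject₁ i) mod n)  ≡⟨ toℕ-fromℕ< (m%n<n (toℕ (inject₁ i)) n) ⟩
    toℕ (inject₁ i) % n          ≡⟨ cong (_% n) (toℕ-inject₁ i) ⟩
    toℕ i % n                    ≡⟨ m<n⇒m%n≡m (toℕ<n i) ⟩
    toℕ i                        ∎))
    where open ≡-Reasoning

  labelling↔ : (Fin n ⊎ Fin (suc n)) ↔ Fin (n + suc n)
  labelling↔ = ↔-sym +↔⊎ ↔-∘ (ρ ⊎-↔ liftLast ρ)

  labelling : Labeling G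
  labelling = Inverse.to labelling↔

  lab-vertex : ∀ v → lab G labelling (inj₁ v) ≡ suc (toℕ (ρ ⟨$⟩ʳ v))
  lab-vertex v = cong suc (toℕ-↑ˡ (ρ ⟨$⟩ʳ v) (suc n))

  lab-cycle : ∀ i → lab G labelling (inj₂ (inject₁ i)) ≡ suc (n + toℕ (ρ ⟨$⟩ʳ i))
  lab-cycle i = cong suc (begin
    toℕ (n ↑ʳ (liftLast ρ ⟨$⟩ʳ inject₁ i))  ≡⟨ toℕ-↑ʳ n _ ⟩
    n + toℕ (liftLast ρ ⟨$⟩ʳ inject₁ i)      ≡⟨ cong (λ j → n + toℕ j) (liftLast-inject₁ ρ i) ⟩
    n + toℕ (inject₁ (ρ ⟨$⟩ʳ i))             ≡⟨ cong (n +_) (toℕ-inject₁ (ρ ⟨$⟩ʳ i)) ⟩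
    n + toℕ (ρ ⟨$⟩ʳ i)                       ∎)
    where open ≡-Reasoning

  lab-chord : lab G labelling (inj₂ (fromℕ n)) ≡ suc (n + n)
  lab-chord = cong suc (begin
    toℕ (n ↑ʳ (liftLast ρ ⟨$⟩ʳ fromℕ n))  ≡⟨ toℕ-↑ʳ n _ ⟩
    n + toℕ (liftLast ρ ⟨$⟩ʳ fromℕ n)      ≡⟨ cong (λ j → n + toℕ j) (liftLast-fromℕ ρ) ⟩
    n + toℕ (fromℕ n)                      ≡⟨ cong (n +_) (toℕ-fromℕ n) ⟩
    n + n                                  ∎)
    where open ≡-Reasoning

  endpoints-coprime : ∀ e → Coprime (lab G labelling (inj₁ (proj₁ (ends G e))))
                                    (lab G labelling (inj₁ (proj₂ (ends G e))))
  endpoints-coprime e with view e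
  ... | ‵fromℕ rewrite ends-chord | lab-vertex a | toℕ-rotation-self a = 1-coprimeTo _
  ... | ‵inject₁ i rewrite ends-cycle i | lab-vertex i | lab-vertex (next n i)
                         | rotate-next (n ∸ toℕ a) i = coprime-next (ρ ⟨$⟩ʳ i)

  source-cycle : ∀ i → IsEndpoint G i (inject₁ i)
  source-cycle i = inj₁ (cong proj₁ (sym (ends-cycle i)))

  target-cycle : ∀ i → IsEndpoint G (next n i) (inject₁ i)
  target-cycle i = inj₂ (cong proj₂ (sym (ends-cycle i)))

  source-chord : IsEndpoint G a (fromℕ n)
  source-chord = inj₁ (cong proj₁ (sym ends-chord))

  edgeLabelGcd≡1-at-a : edgeLabelGcd G labelling a ≡ 1
  edgeLabelGcd≡1-at-a = coprime-edges⇒edgeLabelGcd≡1 G labelling (source-cycle a) source-chord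
    (subst₂ Coprime (sym lab-cycle-a) (sym lab-chord) (coprime-[1+n]-[1+2n] n))
    where
      lab-cycle-a : lab G labelling (inj₂ (inject₁ a)) ≡ suc n
      lab-cycle-a = begin
        lab G labelling (inj₂ (inject₁ a))  ≡⟨ lab-cycle a ⟩
        suc (n + toℕ (ρ ⟨$⟩ʳ a))            ≡⟨ cong (λ k → suc (n + k)) (toℕ-rotation-self a) ⟩
        suc (n + 0)                         ≡⟨ cong suc (+-identityʳ n) ⟩
        suc n                               ∎
        where open ≡-Reasoning

  edgeLabelGcd≡1-off-a : ∀ v {t} → toℕ (ρ ⟨$⟩ʳ v) ≡ suc t → edgeLabelGcd G labelling v ≡ 1
  edgeLabelGcd≡1-off-a v {t} ρv≡1+t =
    coprime-edges⇒edgeLabelGcd≡1 G labelling (source-cycle v) v∈prev-edge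
      (subst₂ Coprime (sym lab-cycle-v) (sym lab-cycle-prev) (Coprime.sym (coprime-suc (suc (n + t)))))
    where
      ρprev≡t : toℕ (ρ ⟨$⟩ʳ prev v) ≡ t
      ρprev≡t = toℕ-next≡suc⇒toℕ≡ (begin
        toℕ (next n (ρ ⟨$⟩ʳ prev v))   ≡⟨ cong toℕ (sym (rotate-next _ (prev v))) ⟩
        toℕ (ρ ⟨$⟩ʳ next n (prev v))   ≡⟨ cong (λ u → toℕ (ρ ⟨$⟩ʳ u)) (next-prev v) ⟩
        toℕ (ρ ⟨$⟩ʳ v)                 ≡⟨ ρv≡1+t ⟩
        suc t                          ∎)
        where open ≡-Reasoning
      v∈prev-edge : IsEndpoint G v (inject₁ (prev v))
      v∈prev-edge = subst (λ u → IsEndpoint G u (inject₁ (prev v))) (next-prev v) (target-cycle (prev v))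
      lab-cycle-v : lab G labelling (inj₂ (inject₁ v)) ≡ suc (suc (n + t))
      lab-cycle-v = trans (lab-cycle v) (cong suc (trans (cong (n +_) ρv≡1+t) (+-suc n t)))
      lab-cycle-prev : lab G labelling (inj₂ (inject₁ (prev v))) ≡ suc (n + t)
      lab-cycle-prev = trans (lab-cycle (prev v)) (cong (λ k → suc (n + k)) ρprev≡t)

  edgeLabelGcd≡1 : ∀ v → edgeLabelGcd G labelling v ≡ 1
  edgeLabelGcd≡1 v with toℕ (ρ ⟨$⟩ʳ v) in ρv≡
  ... | zero  = subst (λ u → edgeLabelGcd G labelling u ≡ 1)
                      (sym (rotation-self-unique a ρv≡)) edgeLabelGcd≡1-at-a
  ... | suc _ = edgeLabelGcd≡1-off-a v ρv≡

  cnPlus-totalPrime : TotalPrime G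
  cnPlus-totalPrime = labelling , record
    { bijective  = Bijection.bijective (Inverse⇒Bijection labelling↔)
    ; vertexCond = endpoints-coprime
    ; edgeCond   = λ v _ → edgeLabelGcd≡1 v
    }

mainTheorem2 : (m : ℕ) → 4 ≤ suc m → (a b : Fin (suc m)) →
                 NonAdjacentOnCycle (suc m) a b → TotalPrime (CnPlus (suc m) a b)
mainTheorem2 _ _ a b _ = cnPlus-totalPrime a b
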